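{- Let $\alpha=\{a_1,\dots,a_n\}$ be a set of $n$ elements, $\delta<n$ a non-negative integer, and $\Gamma:\alpha\to\{0,1,\dots,n\}$ the mapping with $\Gamma(x)=0$ for all $x$. If the procedure $\mathrm{partition}$ described below is invoked as $\mathrm{partition}(\Gamma,1,1,\delta)$, then every mapping $\Gamma$ it reports is a $\delta$-partition of $\alpha$.
   Context: A total mapping $\Gamma:\alpha\to\{0,1,\dots,n\}$ is a partition of $\alpha$ if $\Gamma(x)\neq0$ for all $x$; it is a $\delta$-partition if moreover every nonempty part $\{x:\Gamma(x)=i\}$ ($i\ge1$) has more than $\delta$ elements. Write $N_j=|\{x:\Gamma(x)=j\}|$ for the current $\Gamma$. The recursive procedure $\mathrm{partition}(\Gamma,\rho,i,\delta)$ does the following: (1) set $\Gamma(a_i):=\rho$. (2) Let $\beta=\{j>0:0<N_j\le\delta\}$. (3) If $\beta\neq\emptyset$: let $\mu=\sum_{j\in\beta}(\delta-N_j+1)$; if $\mu>N_0$, return; if $\mu=N_0$, call $\mathrm{partition}(\Gamma,k,i+1,\delta)$ for each $k\in\beta$ in turn, then return. (4) If $i=n$, report $\Gamma$ as a $\delta$-partition and return. (5) Let $m=\max\{\Gamma(a_1),\dots,\Gamma(a_i)\}$; for $k=1,2,\dots,m+1$ in turn call $\mathrm{partition}(\Gamma,k,i+1,\delta)$; then return. When a call returns, the value it assigned to $a_i$ in step (1) is reset to $0$, so each recursive call starts from the caller's current mapping. -}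

module Defs where

open import Data.Nat using (ℕ; zero; suc; _+_; _∸_; _≤_; _<_; _⊔_; _≟_; _≤?_; _<?_)
open import Data.Nat.Properties using (<-cmp)
open import Data.Vec using (Vec; []; _∷_; lookup; replicate; count; toList)
open import Data.Nat.ListAction using (sum)
open import Data.List using (List; []; _∷_; filter; map; upTo; take; foldr; concatMap)
open import Data.Fin using (Fin)
open import Data.Product using (_×_)
open import Relation.Nullary.Decidable using (_×-dec_)
open import Relation.Binary.PropositionalEquality using (_≡_; _≢_)
open import Relation.Binary.Definitions using (tri<; tri≈; tri>)

-- A mapping Γ : α → {0,…,n} with α = {a_1,…,a_n}; entry at position (i-1) is Γ(a_i).
Mapping : ℕ → Set
Mapping n = Vec ℕ n

N : ∀ {n} → Mapping n → ℕ → ℕ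
N Γ j = count (_≟ j) Γ

IsDeltaPartition : (n δ : ℕ) → Mapping n → Set
IsDeltaPartition n δ Γ =
  (∀ (x : Fin n) → lookup Γ x ≤ n) ×
  (∀ (x : Fin n) → lookup Γ x ≢ 0) ×
  (∀ (j : ℕ) → 1 ≤ j → 0 < N Γ j → δ < N Γ j)

setAt : ∀ {n} → ℕ → ℕ → Vec ℕ n → Vec ℕ n
setAt _       v []       = []
setAt zero    v (x ∷ xs) = v ∷ xs
setAt (suc k) v (x ∷ xs) = x ∷ setAt k v xs

oneTo : ℕ → List ℕ
oneTo m = map suc (upTo m)

beta : ∀ {n} → ℕ → Mapping n → List ℕ
beta {n} δ Γ = filter (λ j → (0 <? N Γ j) ×-dec (N Γ j ≤? δ)) (oneTo n)

mu : ∀ {n} → ℕ → Mapping n → ℕ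
mu δ Γ = sum (map (λ j → δ + 1 ∸ N Γ j) (beta δ Γ))

maxPrefix : ∀ {n} → ℕ → Mapping n → ℕ
maxPrefix i Γ = foldr _⊔_ 0 (take i (toList Γ))

-- partition(Γ, ρ, i, δ) where i = n ∸ r  (r = number of elements after a_i).
-- The result is the list of mappings reported (in order).  Recursive calls receive
-- the caller's current mapping; the reset-to-0 on return is automatic since
-- mappings are values.
mutual
  partition : (n δ r : ℕ) → Mapping n → (ρ : ℕ) → List (Mapping n)
  partition n δ r Γ ρ = afterAssign n δ r (setAt (n ∸ r ∸ 1) ρ Γ)

  afterAssign : (n δ r : ℕ) → Mapping n → List (Mapping n)
  afterAssign n δ r Γ with beta δ Γ
  ... | []      = step4 n δ r Γ
  ... | b ∷ bs  with <-cmp (mu δ Γ) (N Γ 0)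
  ...   | tri> _ _ _ = []
  ...   | tri≈ _ _ _ = callEach n δ r Γ (b ∷ bs)
  ...   | tri< _ _ _ = step4 n δ r Γ

  callEach : (n δ r : ℕ) → Mapping n → List ℕ → List (Mapping n)
  callEach n δ zero    Γ ks = []
  callEach n δ (suc r) Γ ks = concatMap (λ k → partition n δ r Γ k) ks

  step4 : (n δ r : ℕ) → Mapping n → List (Mapping n)
  step4 n δ zero    Γ = Γ ∷ []
  step4 n δ (suc r) Γ =
    concatMap (λ k → partition n δ r Γ k) (oneTo (suc (maxPrefix (n ∸ suc r) Γ)))

reported : (n δ : ℕ) → List (Mapping n)
reported n δ = partition n δ (n ∸ 1) (replicate n 0) 1

-- Along every branch of the recursion, when a_i receives a label, a_1, …, a_{i-1} already carry
-- labels in {1, …, i-1} and a_i receives one in {1, …, i}: step (3) only proposes labels of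
-- existing parts, step (5) at most m + 1.  So a mapping reported at i = n has no zero values and
-- values ≤ n, and it is reported only when β = ∅, i.e. when no nonempty part has ≤ δ elements.
module Submission where

open import Defs
open import Data.Nat using (ℕ; zero; suc; _+_; _∸_; _≤_; _<_; _≟_; _<?_; _≤?_; z≤n; s≤s; s≤s⁻¹)
open import Data.Nat.Properties
open import Data.Fin using (Fin; toℕ; zero; suc)
open import Data.Fin.Properties using (toℕ<n)
open import Data.Vec using (Vec; []; _∷_; lookup; replicate; count)
open import Data.Vec.Properties using (lookup-replicate)
open import Data.List using (List; []; _∷_; concatMap)
open import Data.List.Membership.Propositional using (_∈_)
open import Data.List.Membership.Propositional.Properties
  using (∈-map⁺; ∈-map⁻; ∈-upTo⁺; ∈-upTo⁻; ∈-filter⁺; ∈-filter⁻)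
open import Data.List.Relation.Unary.All as All using (All; []; _∷_)
open import Data.List.Relation.Unary.All.Properties using (concat⁺; map⁺)
open import Data.Product using (_×_; _,_; ∃)
open import Function using (_∘_)
open import Relation.Nullary using (¬_; yes; no; contradiction)
open import Relation.Nullary.Decidable using (_×-dec_)
open import Relation.Unary using (Pred; Decidable)
open import Relation.Binary.PropositionalEquality
open import Relation.Binary.Definitions using (tri<; tri≈; tri>)

m+n≡o⇒o∸n≡m : ∀ {m n o} → m + n ≡ o → o ∸ n ≡ m
m+n≡o⇒o∸n≡m {m} {n} refl = m+n∸n≡m m n

lookup-setAt-≡ : ∀ {n} p v (xs : Vec ℕ n) (x : Fin n) → toℕ x ≡ p → lookup (setAt p v xs) x ≡ v
lookup-setAt-≡ zero    v (y ∷ xs) zero    _   = refl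
lookup-setAt-≡ (suc p) v (y ∷ xs) (suc x) x≡p = lookup-setAt-≡ p v xs x (suc-injective x≡p)

lookup-setAt-≢ : ∀ {n} p v (xs : Vec ℕ n) (x : Fin n) → toℕ x ≢ p → lookup (setAt p v xs) x ≡ lookup xs x
lookup-setAt-≢ zero    v (y ∷ xs) zero    x≢p = contradiction refl x≢p
lookup-setAt-≢ zero    v (y ∷ xs) (suc x) _   = refl
lookup-setAt-≢ (suc p) v (y ∷ xs) zero    _   = refl
lookup-setAt-≢ (suc p) v (y ∷ xs) (suc x) x≢p = lookup-setAt-≢ p v xs x (x≢p ∘ cong suc)

module _ {a p} {A : Set a} {P : Pred A p} (P? : Decidable P) where

  count-pos⇒∃ : ∀ {n} (xs : Vec A n) → 0 < count P? xs → ∃ λ x → P (lookup xs x)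
  count-pos⇒∃ (y ∷ xs) pos with P? y
  ... | yes py = zero , py
  ... | no  _  with x , px ← count-pos⇒∃ xs pos = suc x , px

  count-none : ∀ {n} (xs : Vec A n) → (∀ x → ¬ P (lookup xs x)) → count P? xs ≡ 0
  count-none []       _    = refl
  count-none (y ∷ xs) none with P? y
  ... | yes py = contradiction py (none zero)
  ... | no  _  = count-none xs (none ∘ suc)

maxPrefix-≤ : ∀ {n k} p (Γ : Mapping n) → (∀ x → lookup Γ x ≤ k) → maxPrefix p Γ ≤ k
maxPrefix-≤ zero    Γ       _     = z≤n
maxPrefix-≤ (suc p) []      _     = z≤n
maxPrefix-≤ (suc p) (y ∷ Γ) bound = ⊔-lub (bound zero) (maxPrefix-≤ p Γ (bound ∘ suc))

N-pos⇒≤ : ∀ {n k j} (Γ : Mapping n) → (∀ x → lookup Γ x ≤ k) → 0 < N Γ j → j ≤ k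
N-pos⇒≤ Γ bound pos with x , refl ← count-pos⇒∃ (_≟ _) Γ pos = bound x

Label : ℕ → ℕ → Set
Label k j = 1 ≤ j × j ≤ k

Label-weaken : ∀ {k j} → Label k j → Label (suc k) j
Label-weaken (1≤j , j≤k) = 1≤j , m≤n⇒m≤1+n j≤k

∈-oneTo⁻ : ∀ {m j} → j ∈ oneTo m → Label m j
∈-oneTo⁻ j∈ with i , i∈ , refl ← ∈-map⁻ suc j∈ = s≤s z≤n , ∈-upTo⁻ i∈

∈-oneTo⁺ : ∀ {m j} → Label m j → j ∈ oneTo m
∈-oneTo⁺ {j = suc j} (_ , j<m) = ∈-map⁺ suc (∈-upTo⁺ j<m)

oneTo-Labels : ∀ {m k} → m ≤ k → All (Label k) (oneTo m)
oneTo-Labels m≤k = All.tabulate λ j∈ → let 1≤j , j≤m = ∈-oneTo⁻ j∈ in 1≤j , ≤-trans j≤m m≤k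

record Assigned {n} (k : ℕ) (Γ : Mapping n) : Set where
  field
    labels≤  : ∀ x → lookup Γ x ≤ k
    labelled : ∀ x → toℕ x < k → lookup Γ x ≢ 0
open Assigned

Assigned-replicate : ∀ {n} → Assigned 0 (replicate n 0)
Assigned-replicate = record { labels≤ = λ x → ≤-reflexive (lookup-replicate x 0) ; labelled = λ _ () }

Assigned-setAt : ∀ {n k ρ} {Γ : Mapping n} → Assigned k Γ → Label (suc k) ρ →
                 Assigned (suc k) (setAt k ρ Γ)
Assigned-setAt {k = k} {ρ} {Γ} a (1≤ρ , ρ≤1+k) = record { labels≤ = bound ; labelled = nonzero }
  where
  bound : ∀ x → lookup (setAt k ρ Γ) x ≤ suc k
  bound x with toℕ x ≟ k
  ... | yes x≡k = ≤-trans (≤-reflexive (lookup-setAt-≡ k ρ Γ x x≡k)) ρ≤1+k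
  ... | no  x≢k = ≤-trans (≤-reflexive (lookup-setAt-≢ k ρ Γ x x≢k)) (m≤n⇒m≤1+n (labels≤ a x))
  nonzero : ∀ x → toℕ x < suc k → lookup (setAt k ρ Γ) x ≢ 0
  nonzero x x<1+k with toℕ x ≟ k
  ... | yes x≡k = >⇒≢ 1≤ρ ∘ trans (sym (lookup-setAt-≡ k ρ Γ x x≡k))
  ... | no  x≢k = labelled a x (≤∧≢⇒< (s≤s⁻¹ x<1+k) x≢k) ∘ trans (sym (lookup-setAt-≢ k ρ Γ x x≢k))

N₀≡0 : ∀ {n} {Γ : Mapping n} → Assigned n Γ → N Γ 0 ≡ 0
N₀≡0 {Γ = Γ} a = count-none (_≟ 0) Γ λ x → labelled a x (toℕ<n x)

undersized? : ∀ {n} (δ : ℕ) (Γ : Mapping n) → Decidable (λ j → 0 < N Γ j × N Γ j ≤ δ)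
undersized? δ Γ j = (0 <? N Γ j) ×-dec (N Γ j ≤? δ)

beta-Labels : ∀ {n δ k} {Γ : Mapping n} → Assigned k Γ → All (Label k) (beta δ Γ)
beta-Labels {n} {δ} {Γ = Γ} a = All.tabulate λ j∈β →
  let j∈oneTo , pos , _ = ∈-filter⁻ (undersized? δ Γ) {xs = oneTo n} j∈β
      1≤j , _ = ∈-oneTo⁻ j∈oneTo
  in 1≤j , N-pos⇒≤ Γ (labels≤ a) pos

beta-[]⇒δ-partition : ∀ {n δ} {Γ : Mapping n} → Assigned n Γ → beta δ Γ ≡ [] → IsDeltaPartition n δ Γ
beta-[]⇒δ-partition {n} {δ} {Γ} a β≡[] = labels≤ a , (λ x → labelled a x (toℕ<n x)) , large
  where
  large : ∀ j → 1 ≤ j → 0 < N Γ j → δ < N Γ j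
  large j 1≤j pos with N Γ j ≤? δ
  ... | no  N≰δ = ≰⇒> N≰δ
  ... | yes N≤δ = contradiction (subst (j ∈_) β≡[] j∈β) λ ()
    where
    j∈β : j ∈ beta δ Γ
    j∈β = ∈-filter⁺ (undersized? δ Γ) (∈-oneTo⁺ (1≤j , N-pos⇒≤ Γ (labels≤ a) pos)) (pos , N≤δ)

module _ {n δ : ℕ} where

  Sound : List (Mapping n) → Set
  Sound = All (IsDeltaPartition n δ)

  afterAssign-last-sound : ∀ {Γ : Mapping n} → Assigned n Γ → Sound (afterAssign n δ 0 Γ)
  afterAssign-last-sound {Γ} a with beta δ Γ in β≡
  ... | []     = beta-[]⇒δ-partition a β≡ ∷ []
  ... | _ ∷ _  with <-cmp (mu δ Γ) (N Γ 0)
  ...   | tri> _ _ _   = []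
  ...   | tri≈ _ _ _   = []
  ...   | tri< μ<N₀ _ _ = contradiction (subst (mu δ Γ <_) (N₀≡0 a) μ<N₀) n≮0

  mutual
    partition-sound : ∀ {k ρ} r {Γ : Mapping n} → k + suc r ≡ n → Assigned k Γ → Label (suc k) ρ →
                      Sound (partition n δ r Γ ρ)
    partition-sound {k} {ρ} r {Γ} k+1+r≡n a ρ-label =
      subst (λ i → Sound (afterAssign n δ r (setAt i ρ Γ))) (sym position)
        (afterAssign-sound r (trans (sym (+-suc k r)) k+1+r≡n) (Assigned-setAt a ρ-label))
      where
      position : n ∸ r ∸ 1 ≡ k
      position = trans (∸-+-assoc n r 1) (m+n≡o⇒o∸n≡m (trans (cong (k +_) (+-comm r 1)) k+1+r≡n))

    afterAssign-sound : ∀ {k} r {Γ : Mapping n} → k + r ≡ n → Assigned k Γ → Sound (afterAssign n δ r Γ)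
    afterAssign-sound {k} zero {Γ} k+0≡n a =
      afterAssign-last-sound (subst (λ i → Assigned i Γ) (trans (sym (+-identityʳ k)) k+0≡n) a)
    afterAssign-sound (suc r) {Γ} k+1+r≡n a with beta δ Γ in β≡
    ... | []     = step4-sound r k+1+r≡n a
    ... | b ∷ bs with <-cmp (mu δ Γ) (N Γ 0)
    ...   | tri> _ _ _ = []
    ...   | tri≈ _ _ _ = calls-sound r (b ∷ bs) k+1+r≡n a (subst (All _) β≡ (All.map Label-weaken (beta-Labels a)))
    ...   | tri< _ _ _ = step4-sound r k+1+r≡n a

    step4-sound : ∀ {k} r {Γ : Mapping n} → k + suc r ≡ n → Assigned k Γ → Sound (step4 n δ (suc r) Γ)
    step4-sound r {Γ} k+1+r≡n a =
      calls-sound r _ k+1+r≡n a (oneTo-Labels (s≤s (maxPrefix-≤ (n ∸ suc r) Γ (labels≤ a))))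

    calls-sound : ∀ {k} r {Γ : Mapping n} ks → k + suc r ≡ n → Assigned k Γ → All (Label (suc k)) ks →
                  Sound (concatMap (partition n δ r Γ) ks)
    calls-sound r ks k+1+r≡n a labels =
      concat⁺ (map⁺ (All.map (partition-sound r k+1+r≡n a) labels))

proposition4 : ∀ (n δ : ℕ) → δ < n → ∀ (Γ : Mapping n) →
    Γ ∈ reported n δ → IsDeltaPartition n δ Γ
proposition4 (suc n) δ _ Γ Γ∈ =
  All.lookup (partition-sound n refl Assigned-replicate (s≤s z≤n , s≤s z≤n)) Γ∈
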